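{- Let $r\geq 3$ be an integer and let $G$ be a finite simple $K_{1,r}$-free graph. If $\delta(G)\geq \left\lfloor\frac{r}{2}\right\rfloor$, then $G$ has a $\mathcal{P}_{\geq 2}$-factor.
   Context: All graphs are finite and simple. $\delta(G)$ is the minimum degree of $G$. $K_{1,r}$ denotes the star with one center vertex adjacent to $r$ leaves; $G$ is $K_{1,r}$-free if it contains no induced subgraph isomorphic to $K_{1,r}$. For an integer $k\geq 2$, a $\mathcal{P}_{\geq k}$-factor of $G$ is a spanning subgraph of $G$ every connected component of which is a path with at least $k$ vertices. -}

module Defs where

open import Data.Nat using (ℕ; _≤_; _+_)
open import Data.Empty using (⊥)
open import Data.Fin using (Fin)
open import Data.Bool using (Bool; true; false; if_then_else_)
open import Data.List using (List; length; map; concat)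
open import Data.Nat.ListAction using (sum)
open import Data.List.Relation.Unary.All using (All)
open import Data.List.Relation.Unary.Linked using (Linked)
open import Data.List.Relation.Binary.Permutation.Propositional using (_↭_)
open import Data.List.Base using (allFin)
open import Relation.Binary.PropositionalEquality using (_≡_; _≢_)

record Graph (n : ℕ) : Set where
  field
    adj   : Fin n → Fin n → Bool
    sym   : ∀ u v → adj u v ≡ adj v u
    loopless : ∀ v → adj v v ≡ false

open Graph public

Adj : ∀ {n} → Graph n → Fin n → Fin n → Set
Adj G u v = adj G u v ≡ true

degree : ∀ {n} → Graph n → Fin n → ℕ
degree {n} G v = sum (map (λ u → if adj G v u then 1 else 0) (allFin n))

MinDegreeAtLeast : ∀ {n} → Graph n → ℕ → Set
MinDegreeAtLeast G k = ∀ v → k ≤ degree G v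

-- G contains an induced K_{1,r}: a center c and r distinct leaves
-- f 0, …, f (r-1), all adjacent to c, pairwise non-adjacent.
-- (The center differs from every leaf since G is loopless.)
record InducedStar {n} (G : Graph n) (r : ℕ) : Set where
  field
    center : Fin n
    leaf   : Fin r → Fin n
    leaf-injective : ∀ i j → leaf i ≡ leaf j → i ≡ j
    center-adj : ∀ i → Adj G center (leaf i)
    leaves-indep : ∀ i j → i ≢ j → adj G (leaf i) (leaf j) ≡ false

StarFree : ∀ {n} → Graph n → ℕ → Set
StarFree G r = InducedStar G r → ⊥

-- A path of G with at least k vertices, given as its vertex sequence
-- (consecutive vertices adjacent in G; distinctness is enforced by
-- the factor condition below).
record PathAtLeast {n} (G : Graph n) (k : ℕ) (p : List (Fin n)) : Set where
  field
    long   : k ≤ length p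
    linked : Linked (Adj G) p

-- The spanning subgraph formed by the edges of these paths has exactly
-- these paths as its components.
record PathFactor {n} (G : Graph n) (k : ℕ) : Set where
  field
    paths    : List (List (Fin n))
    arePaths : All (PathAtLeast G k) paths
    partition : concat paths ↭ allFin n

-- A 𝒫≥2-factor is the same thing as a spanning forest of stars with one or two leaves. Such a
-- star forest is grown one vertex at a time by an alternating search from an uncovered vertex x:
-- if some neighbour y of x is a leaf, or the centre of a star with fewer than two leaves, x can be
-- covered at once; if y is the centre of a star with two leaves, x may take the place of either
-- leaf l, and the search continues from l. When every branch fails, the centres S visited by the
-- search, together with the set D consisting of x and all leaves of S, form an obstruction in the
-- sense of Akiyama, Avis and Era: D is independent, every neighbour of D lies in S, and
-- |D| = 2|S| + 1. Double counting the edges between D and S rules this out: each vertex of D has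
-- at least k = ⌊r/2⌋ neighbours, all in S, while K_{1,r}-freeness leaves each vertex of S fewer
-- than r ≤ 2k + 1 neighbours in the independent set D; so k|D| ≤ 2k|S| < k|D|.

module Submission where

open import Defs hiding (sym)
open import Data.Nat
open import Data.Nat.Properties
open import Data.Nat.DivMod using (m≡m%n+[m/n]*n; m%n<n; /-monoˡ-≤)
open import Data.Nat.Tactic.RingSolver using (solve-∀)
import Data.Nat.ListAction as List
open import Data.Bool using (Bool; true; false; if_then_else_; _∨_; _∧_; not)
open import Data.Bool.Properties using (∨-zeroʳ; ¬-not)
open import Data.Fin using (Fin; zero; suc)
open import Data.Fin.Properties using (any?) renaming (_≟_ to _≟ᶠ_; suc-injective to suc-injectiveᶠ)
open import Data.Product using (Σ-syntax; _×_; _,_; proj₁; proj₂; ∃-syntax)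
open import Data.Sum using (_⊎_; inj₁; inj₂)
open import Data.Maybe using (Maybe; just; nothing; maybe′)
open import Data.Maybe.Properties using (just-injective) renaming (≡-dec to ≡-decᵐ)
open import Data.Vec.Functional using (Vector; updateAt)
open import Data.Vec.Functional.Properties using (updateAt-updates; updateAt-minimal)
open import Data.List using (List; []; _∷_; _++_; concat; length; filter; tabulate; null)
open import Data.List.Base using (allFin)
open import Data.List.Properties using (map-tabulate; filter-none)
open import Data.List.Relation.Unary.All using (All; []; _∷_)
open import Data.List.Relation.Unary.All.Properties using (tabulate⁺)
open import Data.List.Relation.Unary.Any using (here; there)
open import Data.List.Relation.Unary.Linked using (Linked; [-]; _∷_)
open import Data.List.Membership.Propositional using (_∈_)
open import Data.List.Membership.Propositional.Properties using (∈-∃++; ∈-allFin; ∈-filter⁻; ∈-filter⁺)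
open import Data.List.Relation.Binary.Permutation.Propositional using (_↭_; prep; ↭-refl; ↭-sym; ↭-trans)
open import Data.List.Relation.Binary.Permutation.Propositional.Properties using (shift)
open import Data.Empty using (⊥-elim)
open import Function using (_∘_; id; const)
open import Function.Definitions using (Injective)
open import Relation.Nullary using (Dec; yes; no; does; ¬_; contradiction)
open import Relation.Nullary.Decidable using (dec-true; dec-false; ¬?; _×-dec_; _⊎-dec_)
open import Relation.Binary.Definitions using (DecidableEquality)
open import Relation.Binary.PropositionalEquality
open import Relation.Unary using (Pred; Decidable)
open import Algebra.Properties.Semiring.Sum +-*-semiring
  using (sum; sum-cong-≗; ∑-distrib-+; ∑-comm; *-distribˡ-sum; sum-replicate-zero)

𝟙 : Bool → ℕ
𝟙 b = if b then 1 else 0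

𝟙[_] : ∀ {a} {A : Set a} → Dec A → ℕ
𝟙[ d ] = 𝟙 (does d)

𝟙≤1 : ∀ b → 𝟙 b ≤ 1
𝟙≤1 true  = s≤s z≤n
𝟙≤1 false = z≤n

𝟙[yes] : ∀ {a} {A : Set a} (d : Dec A) → A → 𝟙[ d ] ≡ 1
𝟙[yes] d a = cong 𝟙 (dec-true d a)

𝟙[no] : ∀ {a} {A : Set a} (d : Dec A) → ¬ A → 𝟙[ d ] ≡ 0
𝟙[no] d ¬a = cong 𝟙 (dec-false d ¬a)

∧-true : ∀ {a b} → a ∧ b ≡ true → a ≡ true × b ≡ true
∧-true {true} {true} _ = refl , refl

m≤1+2[m/2] : ∀ m → m ≤ suc (2 * (m / 2))
m≤1+2[m/2] m = begin
  m                  ≡⟨ m≡m%n+[m/n]*n m 2 ⟩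
  m % 2 + m / 2 * 2  ≤⟨ +-monoˡ-≤ (m / 2 * 2) (≤-pred (m%n<n m 2)) ⟩
  1 + m / 2 * 2      ≡⟨ cong suc (*-comm (m / 2) 2) ⟩
  suc (2 * (m / 2))  ∎
  where open ≤-Reasoning

sum-mono-≤ : ∀ {n} {f g : Vector ℕ n} → (∀ i → f i ≤ g i) → sum f ≤ sum g
sum-mono-≤ {zero}  f≤g = z≤n
sum-mono-≤ {suc n} f≤g = +-mono-≤ (f≤g zero) (sum-mono-≤ (f≤g ∘ suc))

sum-≤-n : ∀ {n} (f : Vector ℕ n) → (∀ i → f i ≤ 1) → sum f ≤ n
sum-≤-n {zero}  f f≤1 = z≤n
sum-≤-n {suc n} f f≤1 = +-mono-≤ (f≤1 zero) (sum-≤-n (f ∘ suc) (f≤1 ∘ suc))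

sum-update : ∀ {n} (f g : Vector ℕ n) i → (∀ j → j ≢ i → g j ≡ f j) → sum g + f i ≡ sum f + g i
sum-update {suc n} f g zero g≡f
  rewrite sum-cong-≗ {x = g ∘ suc} {y = f ∘ suc} (λ j → g≡f (suc j) λ ()) = swap-ends (g zero) _ (f zero)
  where
  swap-ends : ∀ a b c → a + b + c ≡ c + b + a
  swap-ends = solve-∀
sum-update {suc n} f g (suc i) g≡f
  rewrite g≡f zero (λ ())
        | +-assoc (f zero) (sum (g ∘ suc)) (f (suc i))
        | +-assoc (f zero) (sum (f ∘ suc)) (g (suc i))
  = cong (f zero +_) (sum-update (f ∘ suc) (g ∘ suc) i (λ j j≢i → g≡f (suc j) (j≢i ∘ suc-injectiveᶠ)))

sum-select : ∀ {n} (f : Vector ℕ n) i → sum (λ j → 𝟙[ i ≟ᶠ j ] * f j) ≡ f i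
sum-select {suc n} f zero    = trans (cong₂ _+_ (*-identityˡ (f zero)) (sum-replicate-zero n)) (+-identityʳ _)
sum-select {suc n} f (suc i) = sum-select (f ∘ suc) i

sum-tabulate : ∀ {n} (f : Vector ℕ n) → List.sum (tabulate f) ≡ sum f
sum-tabulate {zero}  f = refl
sum-tabulate {suc n} f = cong (f zero +_) (sum-tabulate (f ∘ suc))

length-filter-tabulate : ∀ {a p n} {A : Set a} {P : Pred A p} (P? : Decidable P) (f : Fin n → A) →
                         length (filter P? (tabulate f)) ≡ sum (λ i → 𝟙[ P? (f i) ])
length-filter-tabulate {n = zero}  P? f = refl
length-filter-tabulate {n = suc n} P? f with does (P? (f zero))
... | true  = cong suc (length-filter-tabulate P? (f ∘ suc))
... | false = length-filter-tabulate P? (f ∘ suc)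

distinct-witnesses : ∀ {n} (P : Fin n → Bool) r → r ≤ sum (𝟙 ∘ P) →
                     Σ[ f ∈ (Fin r → Fin n) ] Injective _≡_ _≡_ f × (∀ i → P (f i) ≡ true)
distinct-witnesses P zero _ = (λ ()) , (λ { {()} }) , (λ ())
distinct-witnesses {suc n} P (suc r) r≤ with P zero in P0
... | true  = let f , f-injective , Pf = distinct-witnesses (P ∘ suc) r (≤-pred r≤)
              in extend f , extend-injective f-injective , λ { zero → P0 ; (suc i) → Pf i }
  where
  extend : (Fin r → Fin n) → Fin (suc r) → Fin (suc n)
  extend f zero    = zero
  extend f (suc i) = suc (f i)
  extend-injective : ∀ {f} → Injective _≡_ _≡_ f → Injective _≡_ _≡_ (extend f)
  extend-injective f-injective {zero}  {zero}  _  = refl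
  extend-injective f-injective {suc i} {suc j} eq = cong suc (f-injective (suc-injectiveᶠ eq))
... | false = let f , f-injective , Pf = distinct-witnesses (P ∘ suc) (suc r) r≤
              in suc ∘ f , f-injective ∘ suc-injectiveᶠ , Pf

module Multiplicity {a} {A : Set a} (_≟_ : DecidableEquality A) where

  multiplicity : A → List A → ℕ
  multiplicity x []       = 0
  multiplicity x (y ∷ ys) = 𝟙[ x ≟ y ] + multiplicity x ys

  multiplicity-++ : ∀ x xs ys → multiplicity x (xs ++ ys) ≡ multiplicity x xs + multiplicity x ys
  multiplicity-++ x []       ys = refl
  multiplicity-++ x (y ∷ xs) ys =
    trans (cong (𝟙[ x ≟ y ] +_) (multiplicity-++ x xs ys)) (sym (+-assoc 𝟙[ x ≟ y ] _ _))

  multiplicity-self : ∀ x xs → 0 < multiplicity x (x ∷ xs)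
  multiplicity-self x xs rewrite 𝟙[yes] (x ≟ x) refl = s≤s z≤n

  multiplicity>0⇒∈ : ∀ x xs → 0 < multiplicity x xs → x ∈ xs
  multiplicity>0⇒∈ x (y ∷ ys) 0<m with x ≟ y
  ... | yes refl = here refl
  ... | no  _    = there (multiplicity>0⇒∈ x ys 0<m)

  ↭-from-multiplicity : ∀ xs ys → (∀ z → multiplicity z xs ≡ multiplicity z ys) → xs ↭ ys
  ↭-from-multiplicity []       []       _    = ↭-refl
  ↭-from-multiplicity []       (y ∷ ys) same = ⊥-elim (<⇒≢ (multiplicity-self y ys) (same y))
  ↭-from-multiplicity (x ∷ xs) ys       same
    with us , vs , refl ← ∈-∃++ (multiplicity>0⇒∈ x ys (subst (0 <_) (same x) (multiplicity-self x xs)))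
    = ↭-trans (prep x (↭-from-multiplicity xs (us ++ vs) same-rest)) (↭-sym (shift x us vs))
    where
    middle-to-front : ∀ a b c → a + (b + c) ≡ b + (a + c)
    middle-to-front = solve-∀
    same-rest : ∀ z → multiplicity z xs ≡ multiplicity z (us ++ vs)
    same-rest z = +-cancelˡ-≡ 𝟙[ z ≟ x ] _ _ (begin
      𝟙[ z ≟ x ] + multiplicity z xs                        ≡⟨ same z ⟩
      multiplicity z (us ++ x ∷ vs)                         ≡⟨ multiplicity-++ z us (x ∷ vs) ⟩
      multiplicity z us + (𝟙[ z ≟ x ] + multiplicity z vs)  ≡⟨ middle-to-front (multiplicity z us) 𝟙[ z ≟ x ] _ ⟩
      𝟙[ z ≟ x ] + (multiplicity z us + multiplicity z vs)  ≡⟨ cong (𝟙[ z ≟ x ] +_) (multiplicity-++ z us vs) ⟨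
      𝟙[ z ≟ x ] + multiplicity z (us ++ vs)                ∎)
      where open ≡-Reasoning

  multiplicity-filter : ∀ {p} {P : Pred A p} (P? : Decidable P) x xs →
                        multiplicity x (filter P? xs) ≡ 𝟙[ P? x ] * multiplicity x xs
  multiplicity-filter P? x []       = sym (*-zeroʳ 𝟙[ P? x ])
  multiplicity-filter P? x (y ∷ ys) = begin
    multiplicity x (filter P? (y ∷ ys))                     ≡⟨ unfold-filter ⟩
    𝟙[ P? y ] * 𝟙[ x ≟ y ] + multiplicity x (filter P? ys)  ≡⟨ cong₂ _+_ head-term (multiplicity-filter P? x ys) ⟩
    𝟙[ P? x ] * 𝟙[ x ≟ y ] + 𝟙[ P? x ] * multiplicity x ys  ≡⟨ *-distribˡ-+ 𝟙[ P? x ] _ _ ⟨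
    𝟙[ P? x ] * multiplicity x (y ∷ ys)                     ∎
    where
    open ≡-Reasoning
    unfold-filter : multiplicity x (filter P? (y ∷ ys)) ≡ 𝟙[ P? y ] * 𝟙[ x ≟ y ] + multiplicity x (filter P? ys)
    unfold-filter with does (P? y)
    ... | true  = cong (_+ multiplicity x (filter P? ys)) (sym (*-identityˡ 𝟙[ x ≟ y ]))
    ... | false = refl
    head-term : 𝟙[ P? y ] * 𝟙[ x ≟ y ] ≡ 𝟙[ P? x ] * 𝟙[ x ≟ y ]
    head-term with x ≟ y
    ... | yes refl = refl
    ... | no  _    = trans (*-zeroʳ 𝟙[ P? y ]) (sym (*-zeroʳ 𝟙[ P? x ]))

  multiplicity-tabulate : ∀ {n} x (f : Fin n → A) → multiplicity x (tabulate f) ≡ sum (λ i → 𝟙[ x ≟ f i ])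
  multiplicity-tabulate {zero}  x f = refl
  multiplicity-tabulate {suc n} x f = cong (𝟙[ x ≟ f zero ] +_) (multiplicity-tabulate x (f ∘ suc))

  multiplicity-concat-tabulate : ∀ {n} x (f : Fin n → List A) →
                                 multiplicity x (concat (tabulate f)) ≡ sum (λ i → multiplicity x (f i))
  multiplicity-concat-tabulate {zero}  x f = refl
  multiplicity-concat-tabulate {suc n} x f =
    trans (multiplicity-++ x (f zero) _) (cong (multiplicity x (f zero) +_) (multiplicity-concat-tabulate x (f ∘ suc)))

module _ {n : ℕ} where
  open Multiplicity (_≟ᶠ_ {n})

  multiplicity-allFin : ∀ i → multiplicity i (allFin n) ≡ 1
  multiplicity-allFin i = begin
    multiplicity i (allFin n)    ≡⟨ multiplicity-tabulate i id ⟩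
    sum (λ j → 𝟙[ i ≟ᶠ j ])      ≡⟨ sum-cong-≗ (λ j → sym (*-identityʳ 𝟙[ i ≟ᶠ j ])) ⟩
    sum (λ j → 𝟙[ i ≟ᶠ j ] * 1)  ≡⟨ sum-select (λ _ → 1) i ⟩
    1                            ∎
    where open ≡-Reasoning

module _ {a} {A : Set a} where

  dropEmpty : List (List A) → List (List A)
  dropEmpty []               = []
  dropEmpty ([] ∷ xss)       = dropEmpty xss
  dropEmpty ((x ∷ xs) ∷ xss) = (x ∷ xs) ∷ dropEmpty xss

  concat-dropEmpty : ∀ xss → concat (dropEmpty xss) ≡ concat xss
  concat-dropEmpty []               = refl
  concat-dropEmpty ([] ∷ xss)       = concat-dropEmpty xss
  concat-dropEmpty ((x ∷ xs) ∷ xss) = cong ((x ∷ xs) ++_) (concat-dropEmpty xss)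

  All-dropEmpty : ∀ {p} {P : Pred (List A) p} {xss} → All (λ xs → xs ≡ [] ⊎ P xs) xss → All P (dropEmpty xss)
  All-dropEmpty []                                  = []
  All-dropEmpty {xss = [] ∷ _}      (_ ∷ ps)        = All-dropEmpty ps
  All-dropEmpty {xss = (_ ∷ _) ∷ _} (inj₂ px ∷ ps)  = px ∷ All-dropEmpty ps

  ∈⇒non-null : ∀ {x : A} {xs} → x ∈ xs → not (null xs) ≡ true
  ∈⇒non-null (here _)  = refl
  ∈⇒non-null (there _) = refl

module _ {n : ℕ} (G : Graph n) where

  Adj-irrefl : ∀ {x y} → Adj G x y → x ≢ y
  Adj-irrefl {x} xy refl with trans (sym xy) (loopless G x)
  ... | ()

  Adj-sym : ∀ {x y} → Adj G x y → Adj G y x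
  Adj-sym {x} {y} xy = trans (Graph.sym G y x) xy

  degree≡sum : ∀ v → degree G v ≡ sum (λ w → 𝟙 (adj G v w))
  degree≡sum v = trans (cong List.sum (map-tabulate id (λ w → 𝟙 (adj G v w)))) (sum-tabulate (λ w → 𝟙 (adj G v w)))

VertexSet : ℕ → Set
VertexSet n = Fin n → Bool

module _ {n : ℕ} where

  _⊆_ : VertexSet n → VertexSet n → Set
  V ⊆ W = ∀ {z} → V z ≡ true → W z ≡ true

  ∣_∣ : VertexSet n → ℕ
  ∣ V ∣ = sum (𝟙 ∘ V)

  ∅ : VertexSet n
  ∅ _ = false

  ∣∅∣ : ∣ ∅ ∣ ≡ 0
  ∣∅∣ = sum-replicate-zero n

  insert : Fin n → VertexSet n → VertexSet n
  insert y V z = does (z ≟ᶠ y) ∨ V z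

  insert-≢ : ∀ {y z} V → z ≢ y → insert y V z ≡ V z
  insert-≢ {y} {z} V z≢y = cong (_∨ V z) (dec-false (z ≟ᶠ y) z≢y)

  ⊆-insert : ∀ y V → V ⊆ insert y V
  ⊆-insert y V {z} Vz = subst (λ b → does (z ≟ᶠ y) ∨ b ≡ true) (sym Vz) (∨-zeroʳ _)

  ∈-insert : ∀ y V → insert y V y ≡ true
  ∈-insert y V = cong (_∨ V y) (dec-true (y ≟ᶠ y) refl)

  ∣insert∣ : ∀ y V → V y ≡ false → ∣ insert y V ∣ ≡ suc ∣ V ∣
  ∣insert∣ y V Vy = +-cancelʳ-≡ 0 _ _ (begin
    ∣ insert y V ∣ + 0         ≡⟨ cong (λ b → ∣ insert y V ∣ + 𝟙 b) Vy ⟨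
    ∣ insert y V ∣ + 𝟙 (V y)   ≡⟨ sum-update (𝟙 ∘ V) (𝟙 ∘ insert y V) y (λ _ → cong 𝟙 ∘ insert-≢ V) ⟩
    ∣ V ∣ + 𝟙 (insert y V y)   ≡⟨ cong (λ b → ∣ V ∣ + 𝟙 b) (∈-insert y V) ⟩
    ∣ V ∣ + 1                  ≡⟨ +-comm ∣ V ∣ 1 ⟩
    suc ∣ V ∣                  ≡⟨ +-identityʳ _ ⟨
    suc ∣ V ∣ + 0              ∎)
    where open ≡-Reasoning

  ∣∣-mono : ∀ {V W} → V ⊆ W → ∣ V ∣ ≤ ∣ W ∣
  ∣∣-mono {V} {W} V⊆W = sum-mono-≤ 𝟙-mono
    where
    𝟙-mono : ∀ z → 𝟙 (V z) ≤ 𝟙 (W z)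
    𝟙-mono z with V z in Vz
    ... | false = z≤n
    ... | true  = ≤-reflexive (cong 𝟙 (sym (V⊆W Vz)))

  n≤∣∣⇒full : ∀ V → n ≤ ∣ V ∣ → ∀ z → V z ≡ true
  n≤∣∣⇒full V n≤∣V∣ z = ¬-not λ Vz → 1+n≰n (begin
    suc ∣ V ∣       ≡⟨ ∣insert∣ z V Vz ⟨
    ∣ insert z V ∣  ≤⟨ sum-≤-n _ (𝟙≤1 ∘ insert z V) ⟩
    n               ≤⟨ n≤∣V∣ ⟩
    ∣ V ∣           ∎)
    where open ≤-Reasoning

-- Barriers

record Barrier {n : ℕ} (G : Graph n) : Set where
  field
    S D             : VertexSet n
    disjoint        : ∀ {v} → S v ≡ true → D v ≡ false
    neighbours-in-S : ∀ {v w} → D v ≡ true → Adj G v w → S w ≡ true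
    D-large         : 2 * ∣ S ∣ < ∣ D ∣

module _ {n : ℕ} {G : Graph n} where

  Independent : VertexSet n → Set
  Independent D = ∀ {u v} → D u ≡ true → D v ≡ true → adj G u v ≡ false

  starFree⇒few-independent-neighbours : ∀ {r D} → StarFree G r → Independent D →
                                         ∀ w → sum (λ v → 𝟙 (D v ∧ adj G w v)) < r
  starFree⇒few-independent-neighbours {r} {D} star-free independent w = ≰⇒> λ r≤ →
    let leaf , leaf-injective , leaf-ok = distinct-witnesses (λ v → D v ∧ adj G w v) r r≤
    in star-free record
      { center         = w
      ; leaf           = leaf
      ; leaf-injective = λ i j → leaf-injective
      ; center-adj     = proj₂ ∘ ∧-true ∘ leaf-ok
      ; leaves-indep   = λ i j _ → independent (proj₁ (∧-true (leaf-ok i))) (proj₁ (∧-true (leaf-ok j))) }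

  barrier-impossible : ∀ {r k} → StarFree G r → MinDegreeAtLeast G k → 0 < k → r ≤ suc (2 * k) → ¬ Barrier G
  barrier-impossible {r} {k} star-free min-degree 0<k r≤2k+1 barrier = <⇒≱ (*-monoʳ-< k D-large) (begin
    k * ∣ D ∣                                          ≡⟨ *-distribˡ-sum k (𝟙 ∘ D) ⟩
    sum (λ v → k * 𝟙 (D v))                            ≤⟨ sum-mono-≤ degree-bound ⟩
    sum (λ v → 𝟙 (D v) * sum (edge v))                 ≡⟨ sum-cong-≗ (λ v → *-distribˡ-sum (𝟙 (D v)) (edge v)) ⟩
    sum (λ v → sum (λ w → 𝟙 (D v) * edge v w))         ≤⟨ sum-mono-≤ (sum-mono-≤ ∘ edge-into-S) ⟩
    sum (λ v → sum (λ w → 𝟙 (S w) * D-neighbour w v))  ≡⟨ ∑-comm (λ v w → 𝟙 (S w) * D-neighbour w v) ⟩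
    sum (λ w → sum (λ v → 𝟙 (S w) * D-neighbour w v))  ≡⟨ sum-cong-≗ (λ w → *-distribˡ-sum (𝟙 (S w)) (D-neighbour w)) ⟨
    sum (λ w → 𝟙 (S w) * sum (D-neighbour w))          ≤⟨ sum-mono-≤ (λ w → *-monoʳ-≤ (𝟙 (S w)) (few-D-neighbours w)) ⟩
    sum (λ w → 𝟙 (S w) * (2 * k))                      ≡⟨ sum-cong-≗ (λ w → *-comm (𝟙 (S w)) (2 * k)) ⟩
    sum (λ w → 2 * k * 𝟙 (S w))                        ≡⟨ *-distribˡ-sum (2 * k) (𝟙 ∘ S) ⟨
    2 * k * ∣ S ∣                                      ≡⟨ cong (_* ∣ S ∣) (*-comm 2 k) ⟩
    k * 2 * ∣ S ∣                                      ≡⟨ *-assoc k 2 ∣ S ∣ ⟩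
    k * (2 * ∣ S ∣)                                    ∎)
    where
    open Barrier barrier
    open ≤-Reasoning
    instance _ = >-nonZero 0<k
    edge : Fin n → Fin n → ℕ
    edge v w = 𝟙 (adj G v w)
    D-neighbour : Fin n → Fin n → ℕ
    D-neighbour w v = 𝟙 (D v ∧ adj G w v)
    degree-bound : ∀ v → k * 𝟙 (D v) ≤ 𝟙 (D v) * sum (edge v)
    degree-bound v with D v
    ... | false = ≤-reflexive (*-zeroʳ k)
    ... | true  = subst₂ _≤_ (sym (*-identityʳ k)) (trans (degree≡sum G v) (sym (+-identityʳ _))) (min-degree v)
    edge-into-S : ∀ v w → 𝟙 (D v) * edge v w ≤ 𝟙 (S w) * D-neighbour w v
    edge-into-S v w with D v in Dv | adj G v w in vw
    ... | false | _     = z≤n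
    ... | true  | false = z≤n
    ... | true  | true  rewrite neighbours-in-S Dv vw | Adj-sym G vw = ≤-refl
    independent : Independent D
    independent {u} {v} Du Dv with adj G u v in uv
    ... | false = refl
    ... | true  = contradiction (trans (sym Dv) (disjoint (neighbours-in-S Du uv))) λ ()
    few-D-neighbours : ∀ w → sum (D-neighbour w) ≤ 2 * k
    few-D-neighbours w = ≤-pred (≤-trans (starFree⇒few-independent-neighbours star-free independent w) r≤2k+1)

-- Star forests

module StarForests {n : ℕ} (G : Graph n) where

  -- p v ≡ just c makes v a leaf of the star centred at c.
  ParentMap : Set
  ParentMap = Fin n → Maybe (Fin n)

  _≟ᵐ_ : DecidableEquality (Maybe (Fin n))
  _≟ᵐ_ = ≡-decᵐ _≟ᶠ_

  _[_≔_] : ParentMap → Fin n → Maybe (Fin n) → ParentMap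
  p [ x ≔ m ] = updateAt p x (const m)

  updated : ∀ p x m → (p [ x ≔ m ]) x ≡ m
  updated p x m = updateAt-updates x p

  unchanged : ∀ p {x} m {v} → v ≢ x → (p [ x ≔ m ]) v ≡ p v
  unchanged p {x} m {v} v≢x = updateAt-minimal v x p v≢x

  update-cases : ∀ p x m {v c} → (p [ x ≔ m ]) v ≡ just c → (v ≡ x × m ≡ just c) ⊎ (v ≢ x × p v ≡ just c)
  update-cases p x m {v} e with v ≟ᶠ x
  ... | yes refl = inj₁ (refl , trans (sym (updated p x m)) e)
  ... | no  v≢x  = inj₂ (v≢x , trans (sym (unchanged p m v≢x)) e)

  children : ParentMap → Fin n → List (Fin n)
  children p c = filter (λ v → p v ≟ᵐ just c) (allFin n)

  childCount : ParentMap → Fin n → ℕ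
  childCount p c = sum (λ v → 𝟙[ p v ≟ᵐ just c ])

  length-children : ∀ p c → length (children p c) ≡ childCount p c
  length-children p c = length-filter-tabulate (λ v → p v ≟ᵐ just c) id

  ∈-children⁻ : ∀ {p c l} → l ∈ children p c → p l ≡ just c
  ∈-children⁻ {p} {c} = proj₂ ∘ ∈-filter⁻ (λ v → p v ≟ᵐ just c) {xs = allFin n}

  ∈-children⁺ : ∀ {p c l} → p l ≡ just c → l ∈ children p c
  ∈-children⁺ {p} {c} {l} = ∈-filter⁺ (λ v → p v ≟ᵐ just c) (∈-allFin l)

  childCount-update : ∀ p x m c →
                      childCount (p [ x ≔ m ]) c + 𝟙[ p x ≟ᵐ just c ] ≡ childCount p c + 𝟙[ m ≟ᵐ just c ]
  childCount-update p x m c =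
    trans (sum-update (λ v → 𝟙[ p v ≟ᵐ just c ]) (λ v → 𝟙[ (p [ x ≔ m ]) v ≟ᵐ just c ]) x
                      (λ v v≢x → cong (λ z → 𝟙[ z ≟ᵐ just c ]) (unchanged p m v≢x)))
          (cong (λ z → childCount p c + 𝟙[ z ≟ᵐ just c ]) (updated p x m))

  childCount-update-≤ : ∀ p x m c → childCount (p [ x ≔ m ]) c ≤ childCount p c + 𝟙[ m ≟ᵐ just c ]
  childCount-update-≤ p x m c = ≤-trans (m≤m+n _ _) (≤-reflexive (childCount-update p x m c))

  childCount-update-elsewhere : ∀ p x m c → p x ≢ just c → m ≢ just c →
                                childCount (p [ x ≔ m ]) c ≡ childCount p c
  childCount-update-elsewhere p x m c px≢c m≢c = +-cancelʳ-≡ 0 _ _ (begin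
    childCount (p [ x ≔ m ]) c + 0                   ≡⟨ cong (childCount (p [ x ≔ m ]) c +_) (𝟙[no] (p x ≟ᵐ just c) px≢c) ⟨
    childCount (p [ x ≔ m ]) c + 𝟙[ p x ≟ᵐ just c ]  ≡⟨ childCount-update p x m c ⟩
    childCount p c + 𝟙[ m ≟ᵐ just c ]                ≡⟨ cong (childCount p c +_) (𝟙[no] (m ≟ᵐ just c) m≢c) ⟩
    childCount p c + 0                               ∎)
    where open ≡-Reasoning

  Childless : ParentMap → Fin n → Set
  Childless p x = ∀ w → p w ≢ just x

  childCount-childless : ∀ p c → Childless p c → childCount p c ≡ 0
  childCount-childless p c childless =
    trans (sum-cong-≗ (λ v → 𝟙[no] (p v ≟ᵐ just c) (childless v))) (sum-replicate-zero n)

  childCount-childless-≤1 : ∀ p c → Childless p c → childCount p c ≤ 1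
  childCount-childless-≤1 p c childless = subst (_≤ 1) (sym (childCount-childless p c childless)) z≤n

  children-childless : ∀ p c → Childless p c → children p c ≡ []
  children-childless p c childless = filter-none (λ v → p v ≟ᵐ just c) (tabulate⁺ childless)

  childless-detach : ∀ {p x} y → Childless p x → Childless (p [ y ≔ nothing ]) x
  childless-detach {p} y x-childless w e with update-cases p y nothing e
  ... | inj₂ (_ , pw) = x-childless w pw

  sum-maybe : ∀ (f : Fin n → ℕ) m → sum (λ z → f z * 𝟙[ m ≟ᵐ just z ]) ≡ maybe′ f 0 m
  sum-maybe f nothing  = trans (sum-cong-≗ (λ z → *-zeroʳ (f z))) (sum-replicate-zero n)
  sum-maybe f (just c) = trans (sum-cong-≗ (λ z → *-comm (f z) 𝟙[ c ≟ᶠ z ])) (sum-select f c)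

  leavesOf : ParentMap → VertexSet n → VertexSet n
  leavesOf p W v = maybe′ W false (p v)

  ∣leavesOf∣ : ∀ p W → (∀ {z} → W z ≡ true → childCount p z ≡ 2) → ∣ leavesOf p W ∣ ≡ 2 * ∣ W ∣
  ∣leavesOf∣ p W two-leaves = begin
    ∣ leavesOf p W ∣                          ≡⟨ sum-cong-≗ (λ v → trans (𝟙-maybe (p v)) (sym (sum-maybe (𝟙 ∘ W) (p v)))) ⟩
    sum (λ v → sum (λ z → leaf-of v z))       ≡⟨ ∑-comm leaf-of ⟩
    sum (λ z → sum (λ v → leaf-of v z))       ≡⟨ sum-cong-≗ (λ z → *-distribˡ-sum (𝟙 (W z)) (λ v → 𝟙[ p v ≟ᵐ just z ])) ⟨
    sum (λ z → 𝟙 (W z) * childCount p z)      ≡⟨ sum-cong-≗ two-per-root ⟩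
    sum (λ z → 2 * 𝟙 (W z))                   ≡⟨ *-distribˡ-sum 2 (𝟙 ∘ W) ⟨
    2 * ∣ W ∣                                 ∎
    where
    open ≡-Reasoning
    leaf-of : Fin n → Fin n → ℕ
    leaf-of v z = 𝟙 (W z) * 𝟙[ p v ≟ᵐ just z ]
    𝟙-maybe : ∀ m → 𝟙 (maybe′ W false m) ≡ maybe′ (𝟙 ∘ W) 0 m
    𝟙-maybe nothing  = refl
    𝟙-maybe (just z) = refl
    two-per-root : ∀ z → 𝟙 (W z) * childCount p z ≡ 2 * 𝟙 (W z)
    two-per-root z with W z in Wz
    ... | false = refl
    ... | true  = trans (+-identityʳ _) (two-leaves Wz)

  child≢root : ∀ {p : ParentMap} {v c x} → p v ≡ just c → p x ≡ nothing → v ≢ x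
  child≢root pv px refl with trans (sym pv) px
  ... | ()

  record IsStarForest (p : ParentMap) : Set where
    field
      parent-adjacent : ∀ {v c} → p v ≡ just c → Adj G v c
      parent-isRoot   : ∀ {v c} → p v ≡ just c → p c ≡ nothing
      childCount≤2    : ∀ c → childCount p c ≤ 2
  open IsStarForest

  child-childless : ∀ {p v c} → IsStarForest p → p v ≡ just c → Childless p v
  child-childless {p} sf pv w pw = child≢root {p} pv (parent-isRoot sf pw) refl

  empty-forest : IsStarForest (λ _ → nothing)
  empty-forest = record
    { parent-adjacent = λ ()
    ; parent-isRoot   = λ ()
    ; childCount≤2    = λ c → ≤-trans (childCount-childless-≤1 (λ _ → nothing) c λ _ ()) (n≤1+n 1) }

  detach : ∀ {p} x → IsStarForest p → IsStarForest (p [ x ≔ nothing ])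
  detach {p} x sf = record { parent-adjacent = adjacent ; parent-isRoot = isRoot ; childCount≤2 = bounded }
    where
    adjacent : ∀ {v c} → (p [ x ≔ nothing ]) v ≡ just c → Adj G v c
    adjacent e with update-cases p x nothing e
    ... | inj₂ (_ , pv) = parent-adjacent sf pv
    isRoot : ∀ {v c} → (p [ x ≔ nothing ]) v ≡ just c → (p [ x ≔ nothing ]) c ≡ nothing
    isRoot {c = c} e with update-cases p x nothing e | c ≟ᶠ x
    ... | inj₂ _        | yes refl = updated p x nothing
    ... | inj₂ (_ , pv) | no c≢x   = trans (unchanged p nothing c≢x) (parent-isRoot sf pv)
    bounded : ∀ c → childCount (p [ x ≔ nothing ]) c ≤ 2
    bounded c = ≤-trans (childCount-update-≤ p x nothing c) (subst (_≤ 2) (sym (+-identityʳ _)) (childCount≤2 sf c))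

  attach : ∀ {p x y} → IsStarForest p → Adj G x y → p y ≡ nothing → Childless p x → childCount p y ≤ 1 →
           IsStarForest (p [ x ≔ just y ])
  attach {p} {x} {y} sf xy py x-childless y≤1 =
    record { parent-adjacent = adjacent ; parent-isRoot = isRoot ; childCount≤2 = bounded }
    where
    adjacent : ∀ {v c} → (p [ x ≔ just y ]) v ≡ just c → Adj G v c
    adjacent e with update-cases p x (just y) e
    ... | inj₁ (refl , refl) = xy
    ... | inj₂ (_ , pv)      = parent-adjacent sf pv
    isRoot : ∀ {v c} → (p [ x ≔ just y ]) v ≡ just c → (p [ x ≔ just y ]) c ≡ nothing
    isRoot {v} e with update-cases p x (just y) e
    ... | inj₁ (refl , refl) = trans (unchanged p (just y) (Adj-irrefl G xy ∘ sym)) py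
    ... | inj₂ (_ , pv)      = trans (unchanged p (just y) (λ { refl → x-childless v pv })) (parent-isRoot sf pv)
    bounded : ∀ c → childCount (p [ x ≔ just y ]) c ≤ 2
    bounded c with c ≟ᶠ y
    ... | yes refl = ≤-trans (childCount-update-≤ p x (just y) c) (+-mono-≤ y≤1 (𝟙≤1 _))
    ... | no  c≢y  = ≤-trans (childCount-update-≤ p x (just y) c) (subst (_≤ 2) (sym no-increase) (childCount≤2 sf c))
      where
      no-increase : childCount p c + 𝟙[ just y ≟ᵐ just c ] ≡ childCount p c
      no-increase = trans (cong (childCount p c +_) (𝟙[no] (just y ≟ᵐ just c) (c≢y ∘ sym ∘ just-injective)))
                          (+-identityʳ _)

  Isolated : ParentMap → Fin n → Set
  Isolated p x = p x ≡ nothing × Childless p x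

  Covered : ParentMap → Fin n → Set
  Covered p v = (∃[ c ] p v ≡ just c) ⊎ (∃[ w ] p w ≡ just v)

  Improvement : ParentMap → Fin n → Set
  Improvement p x = Σ[ p' ∈ ParentMap ] IsStarForest p' × (∀ {v} → Covered p v → Covered p' v) × Covered p' x

  update-root-keeps-covered : ∀ {p x} m → p x ≡ nothing → ∀ {v} → Covered p v → Covered (p [ x ≔ m ]) v
  update-root-keeps-covered {p} m px (inj₁ (c , pv)) = inj₁ (c , trans (unchanged p m (child≢root {p} pv px)) pv)
  update-root-keeps-covered {p} m px (inj₂ (w , pw)) = inj₂ (w , trans (unchanged p m (child≢root {p} pw px)) pw)

  detach-keeps-covered : ∀ {p l v} → Covered p v → v ≡ l ⊎ p l ≡ just v ⊎ Covered (p [ l ≔ nothing ]) v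
  detach-keeps-covered {p} {l} {v} (inj₁ (c , pv)) with v ≟ᶠ l
  ... | yes v≡l = inj₁ v≡l
  ... | no  v≢l = inj₂ (inj₂ (inj₁ (c , trans (unchanged p nothing v≢l) pv)))
  detach-keeps-covered {p} {l} (inj₂ (w , pw)) with w ≟ᶠ l
  ... | yes refl = inj₂ (inj₁ pw)
  ... | no  w≢l  = inj₂ (inj₂ (inj₂ (w , trans (unchanged p nothing w≢l) pw)))

  attach-to-root : ∀ {p x y} → IsStarForest p → Isolated p x → Adj G x y → p y ≡ nothing →
                   childCount p y ≤ 1 → Improvement p x
  attach-to-root {p} {x} {y} sf (px , x-childless) xy py y≤1 =
    p [ x ≔ just y ] , attach sf xy py x-childless y≤1 , update-root-keeps-covered (just y) px ,
    inj₁ (y , updated p x (just y))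

  steal-leaf : ∀ {p x y c w} → IsStarForest p → Isolated p x → Adj G x y → p y ≡ just c →
               p w ≡ just c → w ≢ y → Improvement p x
  steal-leaf {p} {x} {y} {w = w} sf (px , x-childless) xy py pw w≢y = p' , p'-forest , keeps , covers-x
    where
    q p' : ParentMap
    q  = p [ y ≔ nothing ]
    p' = q [ x ≔ just y ]
    p'-forest : IsStarForest p'
    p'-forest = attach (detach y sf) xy (updated p y nothing) (childless-detach y x-childless)
                       (childCount-childless-≤1 q y (childless-detach y (child-childless sf py)))
    covers-x : Covered p' x
    covers-x = inj₁ (y , updated q x (just y))
    keeps : ∀ {v} → Covered p v → Covered p' v
    keeps cov with detach-keeps-covered {l = y} cov
    ... | inj₁ refl         = inj₂ (x , updated q x (just y))
    ... | inj₂ (inj₁ py≡v)  = inj₂ (w , trans (unchanged q (just y) (child≢root {p} pw px))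
                                             (trans (unchanged p nothing w≢y) (trans pw (trans (sym py) py≡v))))
    ... | inj₂ (inj₂ cov-q) = update-root-keeps-covered (just y) (trans (unchanged p nothing (Adj-irrefl G xy)) px) cov-q

  recenter : ∀ {p x y c} → IsStarForest p → Isolated p x → Adj G x y → p y ≡ just c →
             (∀ w → p w ≡ just c → w ≡ y) → Improvement p x
  recenter {p} {x} {y} {c} sf (px , x-childless) xy py only-child = p' , p'-forest , keeps , covers-x
    where
    q₁ q₂ p' : ParentMap
    q₁ = p [ y ≔ nothing ]
    q₂ = q₁ [ c ≔ just y ]
    p' = q₂ [ x ≔ just y ]
    pc : p c ≡ nothing
    pc = parent-isRoot sf py
    y≢c : y ≢ c
    y≢c = child≢root {p} py pc
    x≢c : x ≢ c
    x≢c refl = x-childless y py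
    y-empty₁ : childCount q₁ y ≡ 0
    y-empty₁ = childCount-childless q₁ y (childless-detach y (child-childless sf py))
    c-childless₁ : Childless q₁ c
    c-childless₁ w e with update-cases p y nothing e
    ... | inj₂ (w≢y , pw) = w≢y (only-child w pw)
    x-childless₂ : Childless q₂ x
    x-childless₂ w e with update-cases q₁ c (just y) e
    ... | inj₁ (_ , y≡x) = Adj-irrefl G xy (sym (just-injective y≡x))
    ... | inj₂ (_ , q₁w) = childless-detach y x-childless w q₁w
    y≤1₂ : childCount q₂ y ≤ 1
    y≤1₂ = ≤-trans (childCount-update-≤ q₁ c (just y) y) (subst (λ k → k + _ ≤ 1) (sym y-empty₁) (𝟙≤1 _))
    p'-forest : IsStarForest p'
    p'-forest = attach (attach (detach y sf) (Adj-sym G (parent-adjacent sf py)) (updated p y nothing) c-childless₁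
                               (subst (_≤ 1) (sym y-empty₁) z≤n))
                       xy (trans (unchanged q₁ (just y) y≢c) (updated p y nothing)) x-childless₂ y≤1₂
    covers-x : Covered p' x
    covers-x = inj₁ (y , updated q₂ x (just y))
    q₂x : q₂ x ≡ nothing
    q₂x = trans (unchanged q₁ (just y) x≢c) (trans (unchanged p nothing (Adj-irrefl G xy)) px)
    p'c : p' c ≡ just y
    p'c = trans (unchanged q₂ (just y) (x≢c ∘ sym)) (updated q₁ c (just y))
    keeps : ∀ {v} → Covered p v → Covered p' v
    keeps cov with detach-keeps-covered {l = y} cov
    ... | inj₁ refl        = inj₂ (x , updated q₂ x (just y))
    ... | inj₂ (inj₁ py≡v) = inj₁ (y , subst (λ v → p' v ≡ just y) (just-injective (trans (sym py) py≡v)) p'c)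
    ... | inj₂ (inj₂ cov₁) = update-root-keeps-covered (just y) q₂x
                               (update-root-keeps-covered (just y) (trans (unchanged p nothing (y≢c ∘ sym)) pc) cov₁)

  FullRoot : ParentMap → Fin n → Set
  FullRoot p z = p z ≡ nothing × childCount p z ≡ 2

  module Exchange {p x y l} (sf : IsStarForest p) (iso : Isolated p x) (xy : Adj G x y) (pl : p l ≡ just y) where

    px : p x ≡ nothing
    px = proj₁ iso

    q p' : ParentMap
    q  = p [ l ≔ nothing ]
    p' = q [ x ≔ just y ]

    py : p y ≡ nothing
    py = parent-isRoot sf pl

    l≢x : l ≢ x
    l≢x = child≢root {p} pl px

    l≢y : l ≢ y
    l≢y = child≢root {p} pl py

    qx : q x ≡ nothing
    qx = trans (unchanged p nothing (l≢x ∘ sym)) px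

    p'-elsewhere : ∀ {v} → v ≢ x → v ≢ l → p' v ≡ p v
    p'-elsewhere v≢x v≢l = trans (unchanged q (just y) v≢x) (unchanged p nothing v≢l)

    y≤1 : childCount q y ≤ 1
    y≤1 = +-cancelʳ-≤ 1 _ 1 (begin
      childCount q y + 1                   ≡⟨ cong (childCount q y +_) (𝟙[yes] (p l ≟ᵐ just y) pl) ⟨
      childCount q y + 𝟙[ p l ≟ᵐ just y ]  ≡⟨ childCount-update p l nothing y ⟩
      childCount p y + 0                   ≤⟨ +-monoˡ-≤ 0 (childCount≤2 sf y) ⟩
      2                                    ∎)
      where open ≤-Reasoning

    forest : IsStarForest p'
    forest = attach (detach l sf) xy (trans (unchanged p nothing (l≢y ∘ sym)) py) (childless-detach l (proj₂ iso)) y≤1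

    p'x : p' x ≡ just y
    p'x = updated q x (just y)

    covers-x : Covered p' x
    covers-x = inj₁ (y , p'x)

    keeps-covered : ∀ {v} → Covered p v → v ≡ l ⊎ Covered p' v
    keeps-covered cov with detach-keeps-covered {l = l} cov
    ... | inj₁ v≡l         = inj₁ v≡l
    ... | inj₂ (inj₁ pl≡v) = inj₂ (subst (Covered p') (just-injective (trans (sym pl) pl≡v)) (inj₂ (x , p'x)))
    ... | inj₂ (inj₂ cov)  = inj₂ (update-root-keeps-covered (just y) qx cov)

    isolates-l : Isolated p' l
    isolates-l = trans (unchanged q (just y) l≢x) (updated p l nothing) , l-childless
      where
      l-childless : Childless p' l
      l-childless w e with update-cases q x (just y) e
      ... | inj₁ (_ , y≡l) = l≢y (sym (just-injective y≡l))
      ... | inj₂ (_ , qw)  = childless-detach l (child-childless sf pl) w qw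

    keeps-children : ∀ {z l'} → z ≢ y → p l' ≡ just z → p' l' ≡ just z
    keeps-children z≢y pl' =
      trans (p'-elsewhere (child≢root {p} pl' px) λ { refl → z≢y (just-injective (trans (sym pl') pl)) }) pl'

    reflects-fullRoot : ∀ {z} → z ≢ y → FullRoot p' z → FullRoot p z
    reflects-fullRoot {z} z≢y (p'z , two) = pz , trans (sym same-count) two
      where
      same-count : childCount p' z ≡ childCount p z
      same-count = trans (childCount-update-elsewhere q x (just y) z (λ e → contradiction (trans (sym qx) e) λ ())
                                                                     (z≢y ∘ sym ∘ just-injective))
                         (childCount-update-elsewhere p l nothing z (z≢y ∘ sym ∘ just-injective ∘ trans (sym pl)) λ ())
      pz : p z ≡ nothing
      pz with z ≟ᶠ x | z ≟ᶠ l
      ... | yes refl | _        = contradiction (trans (sym (updated q x (just y))) p'z) λ ()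
      ... | no _     | yes refl = contradiction (trans (sym (childCount-childless p l (child-childless sf pl)))
                                                       (trans (sym same-count) two)) λ ()
      ... | no z≢x   | no z≢l   = trans (sym (p'-elsewhere z≢x z≢l)) p'z

    lift : Improvement p' l → Improvement p x
    lift (p'' , sf'' , keeps'' , covers-l) = p'' , sf'' , keeps , keeps'' covers-x
      where
      keeps : ∀ {v} → Covered p v → Covered p'' v
      keeps cov with keeps-covered cov
      ... | inj₁ refl = covers-l
      ... | inj₂ cov' = keeps'' cov'

-- The alternating search

module Augmentation {n : ℕ} (G : Graph n) where
  open StarForests G
  open IsStarForest

  Closed : VertexSet n → Fin n → Set
  Closed W x = ∀ {w} → Adj G x w → W w ≡ true

  record Explored (p : ParentMap) (V W : VertexSet n) : Set where
    field
      grows               : V ⊆ W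
      new-fullRoot        : ∀ {z} → W z ≡ true → V z ≡ false → FullRoot p z
      new-children-closed : ∀ {z l} → W z ≡ true → V z ≡ false → p l ≡ just z → Closed W l
  open Explored

  explored-refl : ∀ {p V} → Explored p V V
  explored-refl = record
    { grows               = id
    ; new-fullRoot        = λ Vz Vz' → contradiction (trans (sym Vz) Vz') λ ()
    ; new-children-closed = λ Vz Vz' _ → contradiction (trans (sym Vz) Vz') λ () }

  explored-trans : ∀ {p U V W} → Explored p U V → Explored p V W → Explored p U W
  explored-trans {p} {U} {V} {W} exUV exVW = record
    { grows = grows exVW ∘ grows exUV ; new-fullRoot = fullRoot ; new-children-closed = children-closed }
    where
    fullRoot : ∀ {z} → W z ≡ true → U z ≡ false → FullRoot p z
    fullRoot {z} Wz Uz with V z in Vz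
    ... | true  = new-fullRoot exUV Vz Uz
    ... | false = new-fullRoot exVW Wz Vz
    children-closed : ∀ {z l} → W z ≡ true → U z ≡ false → p l ≡ just z → Closed W l
    children-closed {z} Wz Uz pl with V z in Vz
    ... | true  = grows exVW ∘ new-children-closed exUV Vz Uz pl
    ... | false = new-children-closed exVW Wz Vz pl

  explored-root : ∀ {p y V W} → FullRoot p y → (∀ {l} → p l ≡ just y → Closed W l) →
                  Explored p (insert y V) W → Explored p V W
  explored-root {p} {y} {V} {W} y-full y-children-closed ex = record
    { grows = grows ex ∘ ⊆-insert y V ; new-fullRoot = fullRoot ; new-children-closed = children-closed }
    where
    fullRoot : ∀ {z} → W z ≡ true → V z ≡ false → FullRoot p z
    fullRoot {z} Wz Vz with z ≟ᶠ y
    ... | yes refl = y-full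
    ... | no  z≢y  = new-fullRoot ex Wz (trans (insert-≢ V z≢y) Vz)
    children-closed : ∀ {z l} → W z ≡ true → V z ≡ false → p l ≡ just z → Closed W l
    children-closed {z} Wz Vz pl with z ≟ᶠ y
    ... | yes refl = y-children-closed pl
    ... | no  z≢y  = new-children-closed ex Wz (trans (insert-≢ V z≢y) Vz) pl

  explored-exchange : ∀ {p x y l W W'} (sf : IsStarForest p) (iso : Isolated p x) (xy : Adj G x y)
                      (pl : p l ≡ just y) → W y ≡ true → Explored (Exchange.p' sf iso xy pl) W W' → Explored p W W'
  explored-exchange {y = y} {W = W} sf iso xy pl Wy ex = record
    { grows               = grows ex
    ; new-fullRoot        = λ W'z Wz → reflects-fullRoot (≢y Wz) (new-fullRoot ex W'z Wz)
    ; new-children-closed = λ W'z Wz pl' → new-children-closed ex W'z Wz (keeps-children (≢y Wz) pl') }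
    where
    open Exchange sf iso xy pl
    ≢y : ∀ {z} → W z ≡ false → z ≢ y
    ≢y Wz refl = contradiction (trans (sym Wy) Wz) λ ()

  improve-via-leaf : ∀ {p x y c} → IsStarForest p → Isolated p x → Adj G x y → p y ≡ just c → Improvement p x
  improve-via-leaf {p} {y = y} {c} sf iso xy py with any? (λ w → ¬? (w ≟ᶠ y) ×-dec (p w ≟ᵐ just c))
  ... | yes (w , w≢y , pw) = steal-leaf sf iso xy py pw w≢y
  ... | no  no-sibling     = recenter sf iso xy py only-child
    where
    only-child : ∀ w → p w ≡ just c → w ≡ y
    only-child w pw with w ≟ᶠ y
    ... | yes w≡y = w≡y
    ... | no  w≢y = contradiction (w , w≢y , pw) no-sibling

  Outcome : ParentMap → Fin n → VertexSet n → Set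
  Outcome p x V = Improvement p x ⊎ Σ[ W ∈ VertexSet n ] Explored p V W × Closed W x

  Pending : Fin n → List (Fin n) → VertexSet n → Set
  Pending x ys W = ∀ {w} → Adj G x w → w ∈ ys ⊎ W w ≡ true

  LeavesOutcome : ParentMap → Fin n → List (Fin n) → VertexSet n → Set
  LeavesOutcome p x ls V = Improvement p x ⊎ Σ[ W ∈ VertexSet n ] Explored p V W × (∀ {l} → l ∈ ls → Closed W l)

  pending-step : ∀ {x y ys W W'} → Pending x (y ∷ ys) W → W ⊆ W' → (Adj G x y → W' y ≡ true) → Pending x ys W'
  pending-step pending W⊆W' y-done xw with pending xw
  ... | inj₁ (here refl)  = inj₂ (y-done xw)
  ... | inj₁ (there w∈ys) = inj₁ w∈ys
  ... | inj₂ Ww           = inj₂ (W⊆W' Ww)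

  -- A full root is marked visited before its leaves are explored, so n ∸ ∣ V ∣ bounds the depth of the recursion.
  mutual
    search : ∀ {p x} f → IsStarForest p → Isolated p x → ∀ V → n ≤ ∣ V ∣ + f → Outcome p x V
    search zero    sf iso V n≤ = inj₂ (V , explored-refl , λ {w} _ → n≤∣∣⇒full V (≤-trans n≤ (≤-reflexive (+-identityʳ _))) w)
    search (suc f) sf iso V n≤ = scan f sf iso (allFin n) explored-refl (λ {w} _ → inj₁ (∈-allFin w)) n≤

    scan : ∀ {p x V} f → IsStarForest p → Isolated p x → ∀ ys {W} → Explored p V W → Pending x ys W →
           n ≤ ∣ W ∣ + suc f → Outcome p x V
    scan f sf iso [] {W} ex pending n≤ = inj₂ (W , ex , λ xw → closed (pending xw))
      where
      closed : ∀ {w} → w ∈ [] ⊎ W w ≡ true → W w ≡ true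
      closed (inj₂ Ww) = Ww
    scan {p} {x} f sf iso (y ∷ ys) {W} ex pending n≤ with adj G x y in xy | W y in Wy
    ... | false | _    = scan f sf iso ys ex (pending-step pending id λ xy' → contradiction (trans (sym xy) xy') λ ()) n≤
    ... | true  | true = scan f sf iso ys ex (pending-step pending id λ _ → Wy) n≤
    ... | true  | false with p y in py
    ...   | just c  = inj₁ (improve-via-leaf sf iso xy py)
    ...   | nothing with childCount p y ≤? 1
    ...     | yes y≤1 = inj₁ (attach-to-root sf iso xy py y≤1)
    ...     | no  y≰1 with explore f sf iso xy (children p y) ∈-children⁻ (insert y W) (∈-insert y W) n≤∣W+y∣+f
      where
      n≤∣W+y∣+f : n ≤ ∣ insert y W ∣ + f
      n≤∣W+y∣+f = subst (λ k → n ≤ k + f) (sym (∣insert∣ y W Wy)) (subst (n ≤_) (+-suc ∣ W ∣ f) n≤)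
    ...       | inj₁ improvement                  = inj₁ improvement
    ...       | inj₂ (W' , ex' , children-closed) =
                scan f sf iso ys (explored-trans ex (explored-root (py , y-full) (children-closed ∘ ∈-children⁺) ex'))
                     (pending-step pending W⊆W' λ _ → grows ex' (∈-insert y W))
                     (≤-trans n≤ (+-monoˡ-≤ (suc f) (∣∣-mono {V = W} {W = W'} W⊆W')))
      where
      W⊆W' : W ⊆ W'
      W⊆W' Wz = grows ex' (⊆-insert y W Wz)
      y-full : childCount p y ≡ 2
      y-full = ≤-antisym (childCount≤2 sf y) (≰⇒> y≰1)

    explore : ∀ {p x y} f → IsStarForest p → Isolated p x → Adj G x y →
              ∀ ls → (∀ {l} → l ∈ ls → p l ≡ just y) → ∀ W → W y ≡ true → n ≤ ∣ W ∣ + f →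
              LeavesOutcome p x ls W
    explore f sf iso xy []       _        W _  _  = inj₂ (W , explored-refl , λ ())
    explore {p} {x} {y} f sf iso xy (l ∷ ls) children W Wy n≤ =
      continue (search f (Exchange.forest sf iso xy pl) (Exchange.isolates-l sf iso xy pl) W n≤)
      where
      pl : p l ≡ just y
      pl = children (here refl)
      continue : Outcome (Exchange.p' sf iso xy pl) l W → LeavesOutcome p x (l ∷ ls) W
      continue (inj₁ improvement)           = inj₁ (Exchange.lift sf iso xy pl improvement)
      continue (inj₂ (W₁ , ex₁ , l-closed))
        with explore f sf iso xy ls (children ∘ there) W₁ (grows ex₁ Wy)
                     (≤-trans n≤ (+-monoˡ-≤ f (∣∣-mono {V = W} {W = W₁} (grows ex₁))))
      ... | inj₁ improvement            = inj₁ improvement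
      ... | inj₂ (W₂ , ex₂ , ls-closed) =
            inj₂ (W₂ , explored-trans (explored-exchange sf iso xy pl Wy ex₁) ex₂ ,
                  λ { (here refl) xw → grows ex₂ (l-closed xw) ; (there l∈ls) → ls-closed l∈ls })

  barrier-of-stuck : ∀ {p x W} → Isolated p x → Explored p ∅ W → Closed W x → Barrier G
  barrier-of-stuck {p} {x} {W} (px , x-childless) ex x-closed = record
    { S = W ; D = D ; disjoint = disjoint ; neighbours-in-S = neighbours-in-W
    ; D-large = subst (2 * ∣ W ∣ <_) (sym ∣D∣) ≤-refl }
    where
    D : VertexSet n
    D = insert x (leavesOf p W)
    full : ∀ {z} → W z ≡ true → FullRoot p z
    full Wz = new-fullRoot ex Wz refl
    ∣D∣ : ∣ D ∣ ≡ 1 + 2 * ∣ W ∣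
    ∣D∣ = trans (∣insert∣ x (leavesOf p W) (cong (maybe′ W false) px))
                (cong suc (∣leavesOf∣ p W (proj₂ ∘ full)))
    disjoint : ∀ {v} → W v ≡ true → D v ≡ false
    disjoint {v} Wv = trans (insert-≢ (leavesOf p W) v≢x) (cong (maybe′ W false) (proj₁ (full Wv)))
      where
      v≢x : v ≢ x
      v≢x refl = contradiction (trans (sym (childCount-childless p x x-childless)) (proj₂ (full Wv))) λ ()
    neighbours-in-W : ∀ {v w} → D v ≡ true → Adj G v w → W w ≡ true
    neighbours-in-W {v} Dv vw with v ≟ᶠ x | p v in pv
    ... | yes refl | _      = x-closed vw
    ... | no _     | just z = new-children-closed ex Dv refl pv vw

  uncovered⇒isolated : ∀ {p x} → ¬ Covered p x → Isolated p x
  uncovered⇒isolated {p} {x} uncovered with p x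
  ... | just c  = contradiction (inj₁ (c , refl)) uncovered
  ... | nothing = refl , λ w pw → uncovered (inj₂ (w , pw))

  improve : ∀ {p x} → ¬ Barrier G → IsStarForest p → ¬ Covered p x → Improvement p x
  improve no-barrier sf uncovered
    with search n sf (uncovered⇒isolated uncovered) ∅ (subst (λ k → n ≤ k + n) (sym (∣∅∣ {n})) ≤-refl)
  ... | inj₁ improvement       = improvement
  ... | inj₂ (W , ex , closed) = contradiction (barrier-of-stuck (uncovered⇒isolated uncovered) ex closed) no-barrier

  covered? : ∀ p v → Dec (Covered p v)
  covered? p v = any? (λ c → p v ≟ᵐ just c) ⊎-dec any? (λ w → p w ≟ᵐ just v)

  covering-forest : ¬ Barrier G → ∀ xs → Σ[ p ∈ ParentMap ] IsStarForest p × (∀ {v} → v ∈ xs → Covered p v)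
  covering-forest no-barrier []       = (λ _ → nothing) , empty-forest , λ ()
  covering-forest no-barrier (x ∷ xs) with covering-forest no-barrier xs
  ... | p , sf , covers-xs with covered? p x
  ...   | yes covers-x = p , sf , λ { (here refl) → covers-x ; (there v∈xs) → covers-xs v∈xs }
  ...   | no uncovered with improve no-barrier sf uncovered
  ...     | p' , sf' , keeps , covers-x = p' , sf' , λ { (here refl) → covers-x ; (there v∈xs) → keeps (covers-xs v∈xs) }

-- From a covering star forest to a path factor

module StarPaths {n : ℕ} (G : Graph n) where
  open StarForests G
  open IsStarForest
  open Multiplicity (_≟ᶠ_ {n})

  centredPath : Fin n → List (Fin n) → List (Fin n)
  centredPath c []       = []
  centredPath c (l ∷ ls) = l ∷ c ∷ ls

  multiplicity-centredPath : ∀ a c ls →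
    multiplicity a (centredPath c ls) ≡ 𝟙[ a ≟ᶠ c ] * 𝟙 (not (null ls)) + multiplicity a ls
  multiplicity-centredPath a c []       = sym (trans (+-identityʳ _) (*-zeroʳ 𝟙[ a ≟ᶠ c ]))
  multiplicity-centredPath a c (l ∷ ls) = rearrange 𝟙[ a ≟ᶠ l ] 𝟙[ a ≟ᶠ c ] (multiplicity a ls)
    where
    rearrange : ∀ x y z → x + (y + z) ≡ y * 1 + (x + z)
    rearrange = solve-∀

  centredPath-linked : ∀ {c l ls} → length (l ∷ ls) ≤ 2 → (∀ {v} → v ∈ l ∷ ls → Adj G v c) →
                       Linked (Adj G) (centredPath c (l ∷ ls))
  centredPath-linked {ls = []}        _ leaf-adj = leaf-adj (here refl) ∷ [-]
  centredPath-linked {ls = _ ∷ []}    _ leaf-adj = leaf-adj (here refl) ∷ Adj-sym G (leaf-adj (there (here refl))) ∷ [-]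
  centredPath-linked {ls = _ ∷ _ ∷ _} (s≤s (s≤s ())) _

  module _ {p} (sf : IsStarForest p) (covering : ∀ v → Covered p v) where

    starPath : Fin n → List (Fin n)
    starPath c = centredPath c (children p c)

    starPath-isPath : ∀ c → starPath c ≡ [] ⊎ PathAtLeast G 2 (starPath c)
    starPath-isPath c with children p c in eq
    ... | []     = inj₁ refl
    ... | l ∷ ls = inj₂ (record { long = s≤s (s≤s z≤n) ; linked = centredPath-linked leaves≤2 leaf-adj })
      where
      leaves≤2 : length (l ∷ ls) ≤ 2
      leaves≤2 = subst (_≤ 2) (trans (sym (length-children p c)) (cong length eq)) (childCount≤2 sf c)
      leaf-adj : ∀ {v} → v ∈ l ∷ ls → Adj G v c
      leaf-adj v∈ = parent-adjacent sf (∈-children⁻ (subst (_ ∈_) (sym eq) v∈))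

    starPaths : List (List (Fin n))
    starPaths = dropEmpty (tabulate starPath)

    multiplicity-children : ∀ a c → multiplicity a (children p c) ≡ 1 * 𝟙[ p a ≟ᵐ just c ]
    multiplicity-children a c = begin
      multiplicity a (children p c)                   ≡⟨ multiplicity-filter (λ v → p v ≟ᵐ just c) a (allFin n) ⟩
      𝟙[ p a ≟ᵐ just c ] * multiplicity a (allFin n)  ≡⟨ cong (𝟙[ p a ≟ᵐ just c ] *_) (multiplicity-allFin a) ⟩
      𝟙[ p a ≟ᵐ just c ] * 1                          ≡⟨ *-comm 𝟙[ p a ≟ᵐ just c ] 1 ⟩
      1 * 𝟙[ p a ≟ᵐ just c ]                          ∎
      where open ≡-Reasoning

    covered-once : ∀ a → 𝟙 (not (null (children p a))) + maybe′ (λ _ → 1) 0 (p a) ≡ 1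
    covered-once a with p a in pa | covering a
    ... | just c  | _             = cong (λ ls → 𝟙 (not (null ls)) + 1) (children-childless p a (child-childless sf pa))
    ... | nothing | inj₂ (w , pw) = cong (λ b → 𝟙 b + 0) (∈⇒non-null (∈-children⁺ pw))

    multiplicity-starPaths : ∀ a → multiplicity a (concat starPaths) ≡ multiplicity a (allFin n)
    multiplicity-starPaths a = begin
      multiplicity a (concat starPaths)            ≡⟨ cong (multiplicity a) (concat-dropEmpty (tabulate starPath)) ⟩
      multiplicity a (concat (tabulate starPath))  ≡⟨ multiplicity-concat-tabulate a starPath ⟩
      sum (λ c → multiplicity a (starPath c))      ≡⟨ sum-cong-≗ (λ c → multiplicity-centredPath a c (children p c)) ⟩
      sum (λ c → 𝟙[ a ≟ᶠ c ] * hasLeaves c + multiplicity a (children p c))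
        ≡⟨ ∑-distrib-+ (λ c → 𝟙[ a ≟ᶠ c ] * hasLeaves c) (λ c → multiplicity a (children p c)) ⟩
      sum (λ c → 𝟙[ a ≟ᶠ c ] * hasLeaves c) + sum (λ c → multiplicity a (children p c))
        ≡⟨ cong₂ _+_ (sum-select hasLeaves a) (sum-cong-≗ (multiplicity-children a)) ⟩
      hasLeaves a + sum (λ c → 1 * 𝟙[ p a ≟ᵐ just c ])  ≡⟨ cong (hasLeaves a +_) (sum-maybe (λ _ → 1) (p a)) ⟩
      hasLeaves a + maybe′ (λ _ → 1) 0 (p a)             ≡⟨ covered-once a ⟩
      1                                                  ≡⟨ multiplicity-allFin a ⟨
      multiplicity a (allFin n)                          ∎
      where
      open ≡-Reasoning
      hasLeaves : Fin n → ℕ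
      hasLeaves c = 𝟙 (not (null (children p c)))

    pathFactor : PathFactor G 2
    pathFactor = record
      { paths     = starPaths
      ; arePaths  = All-dropEmpty (tabulate⁺ starPath-isPath)
      ; partition = ↭-from-multiplicity (concat starPaths) (allFin n) multiplicity-starPaths }

pathFactor-of-no-barrier : ∀ {n} (G : Graph n) → ¬ Barrier G → PathFactor G 2
pathFactor-of-no-barrier {n} G no-barrier =
  let _ , sf , covers = Augmentation.covering-forest G no-barrier (allFin n)
  in StarPaths.pathFactor G sf (λ v → covers (∈-allFin v))

corollary1 : (r : ℕ) → 3 ≤ r → (n : ℕ) → (G : Graph n) →
    StarFree G r → MinDegreeAtLeast G (r / 2) → PathFactor G 2
corollary1 r 3≤r n G star-free min-degree =
  pathFactor-of-no-barrier G (barrier-impossible star-free min-degree 0<r/2 (m≤1+2[m/2] r))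
  where
  0<r/2 : 0 < r / 2
  0<r/2 = /-monoˡ-≤ 2 (≤-trans (n≤1+n 2) 3≤r)
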